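{- Let $\mathcal{N}$ be a phylogenetic network on $X$. Then $l(\mathcal{N})=p(\mathcal{N})=t(\mathcal{N})$.
   Context: A phylogenetic network $\mathcal{N}=(V,E)$ on a non-empty finite set $X$ is a rooted acyclic digraph with no parallel edges such that: the unique root has out-degree two; every vertex of out-degree zero has in-degree one, and the set of out-degree-zero vertices (the leaves) is exactly $X$; every other vertex has either in-degree one and out-degree two, or in-degree two and out-degree one (if $|X|=1$, $\mathcal{N}$ may also be the single vertex in $X$). $\mathcal{N}$ is tree-based if it has a rooted spanning tree $(V,E')$, $E'\subseteq E$, all of whose leaves lie in $X$. Definitions: $l(\mathcal{N})$ is the minimum, over all rooted spanning trees of $\mathcal{N}$, of the number of leaves of the spanning tree that lie in $V\setminus X$. $p(\mathcal{N})=d(\mathcal{N})-|X|$, where $d(\mathcal{N})$ is the smallest number of vertex disjoint directed paths (single-vertex paths allowed) that partition $V$. Attaching a new leaf to $\mathcal{N}$ means subdividing an edge $(a,b)$ by a new vertex $w$ (replacing $(a,b)$ by $(a,w),(w,b)$) and adding a new vertex $y$ with edge $(w,y)$, so the leaf set grows by $y$. $t(\mathcal{N})$ is the minimum number of leaves that need to be attached (successively) to $\mathcal{N}$ so that the resulting phylogenetic network is tree-based. -}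

module Defs where

open import Data.Nat using (ℕ; zero; suc; _+_; _≤_)
open import Data.Fin using (Fin; zero; suc; _≟_)
open import Data.Bool using (Bool; true; false; if_then_else_; _∧_; not; T)
open import Data.List using (List; []; _∷_; length; concat; allFin)
open import Data.List.Relation.Unary.All using (All)
open import Data.List.Relation.Unary.Linked using (Linked)
open import Data.List.Relation.Binary.Permutation.Propositional using (_↭_)
open import Data.Product using (Σ; _×_; _,_)
open import Data.Sum using (_⊎_)
open import Relation.Nullary using (¬_)
open import Relation.Nullary.Decidable using (⌊_⌋)
open import Relation.Binary.PropositionalEquality using (_≡_; _≢_)
open import Relation.Binary.Construct.Closure.Transitive using (TransClosure)
open import Relation.Binary.Construct.Closure.ReflexiveTransitive using (Star)

-- Finite digraphs without parallel edges: vertex set Fin n, edge set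
-- given by a Boolean adjacency function ( (u,v) ∈ E  iff  T (E u v) ).

Graph : ℕ → Set
Graph n = Fin n → Fin n → Bool

Edge : ∀ {n} → Graph n → Fin n → Fin n → Set
Edge E u v = T (E u v)

count : ∀ {n} → (Fin n → Bool) → ℕ
count {zero}  f = 0
count {suc n} f = (if f zero then 1 else 0) + count (λ i → f (suc i))

outdeg : ∀ {n} → Graph n → Fin n → ℕ
outdeg E v = count (λ w → E v w)

indeg : ∀ {n} → Graph n → Fin n → ℕ
indeg E v = count (λ u → E u v)

isZero : ℕ → Bool
isZero zero    = true
isZero (suc _) = false

isLeaf : ∀ {n} → Graph n → Fin n → Bool
isLeaf E v = isZero (outdeg E v)

-- |X| : the leaf set X of a network is its set of out-degree-zero vertices
leafCount : ∀ {n} → Graph n → ℕ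
leafCount E = count (isLeaf E)

Acyclic : ∀ {n} → Graph n → Set
Acyclic E = ∀ v → ¬ TransClosure (Edge E) v v

IsNetwork : ∀ {n} → Graph n → Set
IsNetwork {n} E =
  (n ≡ 1 × (∀ u v → ¬ Edge E u v))
  ⊎
  (Acyclic E × Σ (Fin n) λ ρ →
      indeg E ρ ≡ 0 × outdeg E ρ ≡ 2
    × (∀ v → Star (Edge E) ρ v)
    × (∀ v → v ≢ ρ →
          (indeg E v ≡ 1 × outdeg E v ≡ 0)
        ⊎ (indeg E v ≡ 1 × outdeg E v ≡ 2)
        ⊎ (indeg E v ≡ 2 × outdeg E v ≡ 1)))

IsRootedSpanningTree : ∀ {n} → Graph n → Graph n → Set
IsRootedSpanningTree {n} E F =
    (∀ u v → Edge F u v → Edge E u v)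
  × Σ (Fin n) λ r →
      indeg F r ≡ 0
    × (∀ v → v ≢ r → indeg F v ≡ 1)
    × (∀ v → Star (Edge F) r v)

nonXLeaves : ∀ {n} → Graph n → Graph n → ℕ
nonXLeaves E F = count (λ v → isLeaf F v ∧ not (isLeaf E v))

TreeBased : ∀ {n} → Graph n → Set
TreeBased {n} E = Σ (Graph n) λ F →
  IsRootedSpanningTree E F × (∀ v → T (isLeaf F v) → T (isLeaf E v))

IsMin : (ℕ → Set) → ℕ → Set
IsMin P k = P k × (∀ j → P j → k ≤ j)

HasLValue : ∀ {n} → Graph n → ℕ → Set
HasLValue {n} E k = Σ (Graph n) λ F →
  IsRootedSpanningTree E F × nonXLeaves E F ≡ k

IsL : ∀ {n} → Graph n → ℕ → Set
IsL E = IsMin (HasLValue E)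

IsPathPartition : ∀ {n} → Graph n → List (List (Fin n)) → Set
IsPathPartition {n} E ps =
    All (λ p → p ≢ []) ps
  × All (Linked (Edge E)) ps
  × concat ps ↭ allFin n

HasPathPartitionOfSize : ∀ {n} → Graph n → ℕ → Set
HasPathPartitionOfSize {n} E k =
  Σ (List (List (Fin n))) λ ps → IsPathPartition E ps × length ps ≡ k

IsD : ∀ {n} → Graph n → ℕ → Set
IsD E = IsMin (HasPathPartitionOfSize E)

-- p(N) = k  iff  d(N) = k + |X|   (d(N) ≥ |X| always)
IsP : ∀ {n} → Graph n → ℕ → Set
IsP E k = IsD E (k + leafCount E)

-- Attaching a leaf: subdivide the edge (a,b) by a new vertex w and add a
-- new leaf y with edge (w,y).  In the new graph on Fin (2+n), vertex
-- zero is w, vertex (suc zero) is y, and (suc (suc v)) is the old v.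

_==_ : ∀ {n} → Fin n → Fin n → Bool
u == v = ⌊ u ≟ v ⌋

subdivide : ∀ {n} → Graph n → Fin n → Fin n → Graph (suc (suc n))
subdivide E a b zero          zero          = false
subdivide E a b zero          (suc zero)    = true
subdivide E a b zero          (suc (suc v)) = v == b
subdivide E a b (suc zero)    _             = false
subdivide E a b (suc (suc u)) zero          = u == a
subdivide E a b (suc (suc u)) (suc zero)    = false
subdivide E a b (suc (suc u)) (suc (suc v)) = E u v ∧ not ((u == a) ∧ (v == b))

AnyGraph : Set
AnyGraph = Σ ℕ Graph

data AttachSeq : ℕ → AnyGraph → AnyGraph → Set where
  done : ∀ {N} → AttachSeq 0 N N
  step : ∀ {k n} {E : Graph n} {N'} (a b : Fin n) → Edge E a b →
         AttachSeq k (suc (suc n) , subdivide E a b) N' →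
         AttachSeq (suc k) (n , E) N'

CanBeMadeTreeBasedWith : ∀ {n} → Graph n → ℕ → Set
CanBeMadeTreeBasedWith {n} E k =
  Σ AnyGraph λ N' → AttachSeq k (n , E) N' × TreeBased (Data.Product.proj₂ N')

IsT : ∀ {n} → Graph n → ℕ → Set
IsT E = IsMin (CanBeMadeTreeBasedWith E)

-- Only three features of a phylogenetic network are used: it is acyclic, its root is its
-- only vertex of in-degree zero, and X is its set of vertices of out-degree zero.  In such a
-- DAG a rooted spanning tree is the same as a parent map choosing an in-neighbour of every
-- non-root vertex, and its leaves are the vertices of X together with its leaves outside X.
-- Let k = l(N), realised by a spanning tree T.
-- t(N) = k: attaching a leaf on an edge leaving a leaf v ∉ X of T extends T to a spanning
-- tree of the new network in which v is no longer a leaf, so k attachments make N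
-- tree-based; conversely, contracting one attachment maps a spanning tree of the larger
-- network to one of N with at most one more leaf outside X.
-- d(N) = |X| + k: letting every inner vertex of T continue the path of one chosen child
-- partitions V into as many paths as T has leaves; conversely, taking path predecessors as
-- parents yields a spanning tree all of whose leaves end a path.

module Submission where

open import Defs

open import Algebra.Properties.CommutativeSemigroup using (x∙yz≈y∙xz)
open import Data.Bool using (Bool; true; false; if_then_else_; _∧_; _∨_; not; T)
open import Data.Bool.Properties
  using (∧-identityʳ; ∧-zeroʳ; ∧-inverseʳ; ∧-assoc; ∧-comm; ∨-identityʳ; T-≡; T-∧; T-∨; T-not-≡)
open import Data.Empty using (⊥; ⊥-elim)
open import Data.Fin using (Fin; zero; suc; _≟_; toℕ)
open import Data.Fin.Properties using (pigeonhole; toℕ<n; any?; all?) renaming (suc-injective to suc-injectiveᶠ)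
open import Data.List
  using (List; []; _∷_; [_]; _++_; length; concat; map; mapMaybe; last; allFin; filterᵇ)
  renaming (tabulate to tabulateᴸ)
open import Data.List.Properties
  using (length-map; length-tabulate; length-mapMaybe; ++-conicalʳ; ++-assoc; concat-map-[_]; map-∘; map-id-local)
open import Data.List.Membership.Propositional using (_∈_; _∉_; lose)
open import Data.List.Membership.Propositional.Properties using (∈-∃++; ∈-concat⁻′; ∈-allFin; ∈-map⁺; ∈-++⁻)
open import Data.List.Relation.Binary.Permutation.Propositional as ↭
  using (_↭_; prep; swap; ↭-refl; ↭-sym; ↭-trans; ↭⇒↭ₛ)
open import Data.List.Relation.Binary.Permutation.Propositional.Properties
  using (++⁺ˡ; shift; shifts; ↭-length; All-resp-↭; Any-resp-↭; ∈-resp-↭)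
import Data.List.Relation.Binary.Permutation.Setoid.Properties as ↭ₛ
open import Data.List.Relation.Unary.All as All using (All; _∷_)
import Data.List.Relation.Unary.All.Properties as Allₚ
open import Data.List.Relation.Unary.AllPairs using (_∷_)
open import Data.List.Relation.Unary.Any as Any using (Any; here; there; satisfied)
import Data.List.Relation.Unary.Any.Properties as Anyₚ
open import Data.List.Relation.Unary.Linked using (Linked; [-]; _∷_)
open import Data.List.Relation.Unary.Unique.Propositional using (Unique)
import Data.List.Relation.Unary.Unique.Propositional.Properties as Uniqueₚ
open import Data.Maybe using (just)
open import Data.Maybe.Relation.Unary.Any using (just) renaming (Any to MaybeAny)
open import Data.Nat using (ℕ; zero; suc; _+_; _≤_; _<_; z≤n; s≤s) renaming (_≟_ to _≟ℕ_)
open import Data.Nat.Induction using (<-wellFounded)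
open import Data.Nat.Properties hiding (_≟_)
open import Data.Product using (Σ; ∃; ∃₂; _×_; _,_; proj₁; proj₂)
open import Data.Sum using (_⊎_; inj₁; inj₂)
open import Data.Vec using (Vec; []; _∷_; lookup; tabulate)
open import Data.Vec.Properties using (lookup∘tabulate)
open import Function.Base using (id; _∘_; flip; case_of_)
open import Function.Bundles using (Equivalence)
open import Induction.WellFounded using (WellFounded; Acc; acc)
open import Relation.Binary.Construct.Closure.ReflexiveTransitive using (Star; ε; _◅_; _◅◅_; gmap)
open import Relation.Binary.Construct.Closure.Transitive using (TransClosure; _∷_) renaming ([_] to [_]⁺)
open import Relation.Binary.PropositionalEquality hiding ([_])
open import Relation.Nullary using (¬_; yes; no; Dec)
open import Relation.Nullary.Decidable
  using (isYes≗does; dec-true; dec-false; ⌊⌋-map′; toWitness; map′; ¬?; _→-dec_; _×-dec_; T?)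
open import Relation.Unary using (Decidable)

open Equivalence using (to; from)

private variable
  n : ℕ

==-refl : (a : Fin n) → (a == a) ≡ true
==-refl a = trans (isYes≗does (a ≟ a)) (dec-true (a ≟ a) refl)

≢⇒==-false : {a b : Fin n} → a ≢ b → (a == b) ≡ false
≢⇒==-false {a = a} {b} a≢b = trans (isYes≗does (a ≟ b)) (dec-false (a ≟ b) a≢b)

==⇒≡ : {a b : Fin n} → T (a == b) → a ≡ b
==⇒≡ = toWitness

suc-== : (i a : Fin n) → (suc i == suc a) ≡ (i == a)
suc-== i a = ⌊⌋-map′ _ _ (i ≟ a)

T-isZero : ∀ {k} → T (isZero k) → k ≡ 0
T-isZero {zero} _ = refl

≢0⇒isZero≡false : ∀ {k} → k ≢ 0 → isZero k ≡ false
≢0⇒isZero≡false {zero}  k≢0 = ⊥-elim (k≢0 refl)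
≢0⇒isZero≡false {suc _} _   = refl

isZero≡false⇒≢0 : ∀ {k} → isZero k ≡ false → k ≢ 0
isZero≡false⇒≢0 {zero} () _

¬T⇒≡false : ∀ {b} → ¬ T b → b ≡ false
¬T⇒≡false {false} _  = refl
¬T⇒≡false {true}  ¬t = ⊥-elim (¬t _)

T-not-==⇒≢ : {i a : Fin n} → T (not (i == a)) → i ≢ a
T-not-==⇒≢ {a = a} t refl = subst (T ∘ not) (==-refl a) t

≢⇒T-not-== : {i a : Fin n} → i ≢ a → T (not (i == a))
≢⇒T-not-== i≢a = from T-not-≡ (≢⇒==-false i≢a)

indicator : Bool → ℕ
indicator b = if b then 1 else 0

count-cong : {f g : Fin n → Bool} → (∀ i → f i ≡ g i) → count f ≡ count g
count-cong {zero}  _   = refl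
count-cong {suc n} f≗g rewrite f≗g zero = cong (_ +_) (count-cong (f≗g ∘ suc))

count-false : (f : Fin n → Bool) → (∀ i → f i ≡ false) → count f ≡ 0
count-false {zero}  _ _  = refl
count-false {suc n} f f≗false rewrite f≗false zero = count-false (f ∘ suc) (f≗false ∘ suc)

count≡0⇒¬T : (f : Fin n → Bool) → count f ≡ 0 → ∀ i → ¬ T (f i)
count≡0⇒¬T {suc n} f c≡0 zero    t rewrite to T-≡ t = case c≡0 of λ ()
count≡0⇒¬T {suc n} f c≡0 (suc i) t = count≡0⇒¬T (f ∘ suc) (m+n≡0⇒n≡0 (indicator (f zero)) c≡0) i t

count≢0⇒∃T : (f : Fin n → Bool) → count f ≢ 0 → ∃ λ i → T (f i)
count≢0⇒∃T {zero}  f c≢0 = ⊥-elim (c≢0 refl)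
count≢0⇒∃T {suc n} f c≢0 with f zero in eq
... | true  = zero , from T-≡ eq
... | false = let i , t = count≢0⇒∃T (f ∘ suc) c≢0 in suc i , t

count-mono : (f g : Fin n → Bool) → (∀ i → T (f i) → T (g i)) → count f ≤ count g
count-mono {zero}  f g f⊆g = z≤n
count-mono {suc n} f g f⊆g with f zero in ef | g zero in eg
... | true  | true  = s≤s (count-mono (f ∘ suc) (g ∘ suc) (f⊆g ∘ suc))
... | true  | false = ⊥-elim (subst T eg (f⊆g zero (from T-≡ ef)))
... | false | true  = m≤n⇒m≤1+n (count-mono (f ∘ suc) (g ∘ suc) (f⊆g ∘ suc))
... | false | false = count-mono (f ∘ suc) (g ∘ suc) (f⊆g ∘ suc)

count-∧-partition : (f g : Fin n → Bool) → count f ≡ count (λ i → f i ∧ g i) + count (λ i → f i ∧ not (g i))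
count-∧-partition {zero}  f g = refl
count-∧-partition {suc n} f g with f zero | g zero
... | true  | true  = cong suc (count-∧-partition (f ∘ suc) (g ∘ suc))
... | true  | false = trans (cong suc (count-∧-partition (f ∘ suc) (g ∘ suc))) (sym (+-suc _ _))
... | false | true  = count-∧-partition (f ∘ suc) (g ∘ suc)
... | false | false = count-∧-partition (f ∘ suc) (g ∘ suc)

count+count-not : (f : Fin n → Bool) → count f + count (not ∘ f) ≡ n
count+count-not {zero}  f = refl
count+count-not {suc n} f with f zero
... | true  = cong suc (count+count-not (f ∘ suc))
... | false = trans (+-suc _ _) (cong suc (count+count-not (f ∘ suc)))

count-point : (f : Fin n → Bool) (a : Fin n) → count f ≡ indicator (f a) + count (λ i → f i ∧ not (i == a))
count-point {suc n} f zero rewrite ∧-zeroʳ (f zero) =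
  cong (indicator (f zero) +_) (count-cong (λ i → sym (∧-identityʳ (f (suc i)))))
count-point {suc n} f (suc a) = begin
  fz + count (f ∘ suc)                          ≡⟨ cong (fz +_) (count-point (f ∘ suc) a) ⟩
  fz + (fa + rest)                              ≡⟨ x∙yz≈y∙xz +-commutativeSemigroup fz fa rest ⟩
  fa + (fz + rest)                              ≡⟨ cong (λ b → fa + (indicator b + rest)) (∧-identityʳ (f zero)) ⟨
  fa + (indicator (f zero ∧ true) + rest)       ≡⟨ cong (λ k → fa + (indicator (f zero ∧ true) + k)) rest≡ ⟩
  fa + count (λ i → f i ∧ not (i == suc a))     ∎
  where
  open ≡-Reasoning
  fz   = indicator (f zero)
  fa   = indicator (f (suc a))
  rest = count (λ i → f (suc i) ∧ not (i == a))
  rest≡ : rest ≡ count (λ i → f (suc i) ∧ not (suc i == suc a))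
  rest≡ = count-cong (λ i → cong (λ b → f (suc i) ∧ not b) (sym (suc-== i a)))

count-== : (a : Fin n) → count (_== a) ≡ 1
count-== a rewrite count-point (_== a) a | ==-refl a =
  cong suc (count-false _ (λ i → ∧-inverseʳ (i == a)))

count-remove : (f : Fin n → Bool) (a : Fin n) → T (f a) → count f ≡ suc (count (λ i → f i ∧ not (i == a)))
count-remove f a t rewrite count-point f a | to T-≡ t = refl

count≡1⇒unique : (f : Fin n → Bool) → count f ≡ 1 → ∀ {i j} → T (f i) → T (f j) → i ≡ j
count≡1⇒unique f c≡1 {i} {j} fi fj with j ≟ i
... | yes j≡i = sym j≡i
... | no  j≢i = ⊥-elim (count≡0⇒¬T _ (suc-injective (trans (sym (count-remove f i fi)) c≡1)) j
                          (from T-∧ (fj , ≢⇒T-not-== j≢i)))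

count-except : (f g : Fin n → Bool) (a : Fin n) → (∀ i → i ≢ a → T (f i) → T (g i)) → count f ≤ suc (count g)
count-except f g a f⊆g rewrite count-point f a = +-mono-≤ indicator≤1 (count-mono _ g f∖a⊆g)
  where
  indicator≤1 : indicator (f a) ≤ 1
  indicator≤1 with f a
  ... | true  = ≤-refl
  ... | false = z≤n
  f∖a⊆g : ∀ i → T (f i ∧ not (i == a)) → T (g i)
  f∖a⊆g i t = let fi , i≢a = to T-∧ t in f⊆g i (T-not-==⇒≢ i≢a) fi

count-∨-point : (g : Fin n → Bool) (a : Fin n) (c : Bool) → (c ≡ true → g a ≡ false) →
                count (λ i → g i ∨ ((i == a) ∧ c)) ≡ indicator c + count g
count-∨-point g a c c⇒¬ga = begin
  count h                                                        ≡⟨ count-point h a ⟩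
  indicator (h a) + count (λ i → h i ∧ not (i == a))            ≡⟨ cong (indicator (h a) +_) (count-cong off-a) ⟩
  indicator (h a) + count (λ i → g i ∧ not (i == a))            ≡⟨ on-a c c⇒¬ga ⟩
  indicator c + (indicator (g a) + count (λ i → g i ∧ not (i == a))) ≡⟨ cong (indicator c +_) (count-point g a) ⟨
  indicator c + count g                                          ∎
  where
  open ≡-Reasoning
  h : Fin _ → Bool
  h i = g i ∨ ((i == a) ∧ c)
  off-a : ∀ i → ((g i ∨ ((i == a) ∧ c)) ∧ not (i == a)) ≡ (g i ∧ not (i == a))
  off-a i with i == a
  ... | true  = trans (∧-zeroʳ _) (sym (∧-zeroʳ (g i)))
  ... | false = cong (_∧ true) (∨-identityʳ (g i))
  on-a : ∀ c → (c ≡ true → g a ≡ false) → ∀ {k} →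
         indicator (g a ∨ ((a == a) ∧ c)) + k ≡ indicator c + (indicator (g a) + k)
  on-a c c⇒¬ga rewrite ==-refl a with c
  ... | true  rewrite c⇒¬ga refl = refl
  ... | false rewrite ∨-identityʳ (g a) = refl

count-suc-≤ : (f : Fin (suc n) → Bool) → count (f ∘ suc) ≤ count f
count-suc-≤ f = m≤n+m (count (f ∘ suc)) (indicator (f zero))

count-≤-length : (f : Fin n → Bool) (xs : List (Fin n)) → (∀ i → T (f i) → i ∈ xs) → count f ≤ length xs
count-≤-length f []       f⊆xs = ≤-reflexive (count-false f (λ i → ¬T⇒≡false (λ t → case f⊆xs i t of λ ())))
count-≤-length f (x ∷ xs) f⊆xs = ≤-trans (count-except f g x f∖x⊆g) (s≤s (count-≤-length g xs g⊆xs))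
  where
  g : Fin _ → Bool
  g i = f i ∧ not (i == x)
  f∖x⊆g : ∀ i → i ≢ x → T (f i) → T (g i)
  f∖x⊆g i i≢x fi = from T-∧ (fi , ≢⇒T-not-== i≢x)
  g⊆xs : ∀ i → T (g i) → i ∈ xs
  g⊆xs i t with to T-∧ t
  ... | fi , i≢x with f⊆xs i fi
  ...   | here i≡x  = ⊥-elim (T-not-==⇒≢ i≢x i≡x)
  ...   | there i∈xs = i∈xs

-- Well-foundedness of finite acyclic relations

module _ {R : Fin n → Fin n → Set} (acyclic : ∀ v → ¬ TransClosure R v v) where

  DescendingChain : Fin n → ℕ → Set
  DescendingChain v k = Σ (ℕ → Fin n) λ c → c 0 ≡ v × (∀ i → i < k → R (c (suc i)) (c i))

  private
    chain⇒TransClosure : ∀ {k} (c : ℕ → Fin n) → (∀ i → i < k → R (c (suc i)) (c i)) →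
                         ∀ {i j} → i < j → j ≤ k → TransClosure R (c j) (c i)
    chain⇒TransClosure c desc {i} {suc j} (s≤s i≤j) 1+j≤k with m≤n⇒m<n∨m≡n i≤j
    ... | inj₂ refl = [ desc j 1+j≤k ]⁺
    ... | inj₁ i<j  = desc j 1+j≤k ∷ chain⇒TransClosure c desc i<j (<⇒≤ 1+j≤k)

  -- pigeonhole: a longer chain repeats a vertex, closing a cycle
  chain-length<n : ∀ {v k} → DescendingChain v k → k < n
  chain-length<n {k = k} (c , _ , desc) with n ≤? k
  ... | no n≰k = ≰⇒> n≰k
  ... | yes n≤k with pigeonhole (s≤s n≤k) (c ∘ toℕ)
  ...   | i , j , i<j , cᵢ≡cⱼ = ⊥-elim (acyclic (c (toℕ j))
            (subst (TransClosure R (c (toℕ j))) cᵢ≡cⱼ (chain⇒TransClosure c desc i<j (≤-pred (toℕ<n j)))))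

  private
    bounded-chains⇒Acc : ∀ b v → (∀ {k} → DescendingChain v k → k < b) → Acc R v
    bounded-chains⇒Acc zero    v bounded = case bounded {0} ((λ _ → v) , refl , λ _ ()) of λ ()
    bounded-chains⇒Acc (suc b) v bounded =
      acc λ uRv → bounded-chains⇒Acc b _ (λ chain → ≤-pred (bounded (extend uRv chain)))
      where
      extend : ∀ {u k} → R u v → DescendingChain u k → DescendingChain v (suc k)
      extend {u} uRv (c , c0≡u , desc) = c′ , refl , desc′
        where
        c′ : ℕ → Fin _
        c′ zero    = v
        c′ (suc i) = c i
        desc′ : ∀ i → i < suc _ → R (c′ (suc i)) (c′ i)
        desc′ zero    _         = subst (λ x → R x v) (sym c0≡u) uRv
        desc′ (suc i) (s≤s i<k) = desc i i<k

  acyclic⇒wellFounded : WellFounded R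
  acyclic⇒wellFounded v = bounded-chains⇒Acc n v chain-length<n

least : {P : ℕ → Set} → Decidable P → ∀ {k} → P k → Σ ℕ (IsMin P)
least {P = P} P? {k} pk = go k pk (<-wellFounded k)
  where
  go : ∀ k → P k → Acc _<_ k → Σ ℕ (IsMin P)
  go k pk (acc smaller) with anyUpTo? P? k
  ... | yes (j , j<k , pj) = go j pj (smaller j<k)
  ... | no  none           = k , pk , λ j pj → ≮⇒≥ (λ j<k → none (j , j<k , pj))

anyVec? : ∀ {k} m {P : Vec (Fin k) m → Set} → Decidable P → Dec (∃ P)
anyVec? zero    P? with P? []
... | yes p = yes ([] , p)
... | no ¬p = no λ { ([] , p) → ¬p p }
anyVec? (suc m) P? with any? (λ x → anyVec? m (P? ∘ (x ∷_)))
... | yes (x , xs , p) = yes (x ∷ xs , p)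
... | no ¬p            = no λ { (x ∷ xs , p) → ¬p (x , xs , p) }

-- Spanning trees and parent maps

_⊆ᴳ_ : Graph n → Graph n → Set
F ⊆ᴳ E = ∀ u v → Edge F u v → Edge E u v

indeg-mono : {F E : Graph n} → F ⊆ᴳ E → ∀ v → indeg F v ≤ indeg E v
indeg-mono F⊆E v = count-mono _ _ (λ u → F⊆E u v)

source⇒noEdgeTo : {E : Graph n} {ρ : Fin n} → indeg E ρ ≡ 0 → ∀ u → ¬ Edge E u ρ
source⇒noEdgeTo ρ-source = count≡0⇒¬T _ ρ-source

spanningTree-root : {E F : Graph n} {ρ : Fin n} → indeg E ρ ≡ 0 →
                    (tree : IsRootedSpanningTree E F) → proj₁ (proj₂ tree) ≡ ρ
spanningTree-root {ρ = ρ} ρ-source (F⊆E , r , _ , indeg≡1 , _) with r ≟ ρ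
... | yes r≡ρ = r≡ρ
... | no  r≢ρ = case ≤-trans (≤-reflexive (sym (indeg≡1 ρ (r≢ρ ∘ sym))))
                             (≤-trans (indeg-mono F⊆E ρ) (≤-reflexive ρ-source)) of λ ()

nonXLeaves-cong : {E F G : Graph n} → (∀ u v → F u v ≡ G u v) → nonXLeaves E F ≡ nonXLeaves E G
nonXLeaves-cong {E = E} F≗G =
  count-cong (λ v → cong (λ k → isZero k ∧ not (isLeaf E v)) (count-cong (F≗G v)))

record IsRootedDAG (E : Graph n) : Set where
  field
    root        : Fin n
    root-source : indeg E root ≡ 0
    has-parent  : ∀ v → v ≢ root → indeg E v ≢ 0
    acyclic     : Acyclic E

module RootedDAG {E : Graph n} (dag : IsRootedDAG E) where

  open IsRootedDAG dag

  IsParentMap : (Fin n → Fin n) → Set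
  IsParentMap par = ∀ v → v ≢ root → Edge E (par v) v

  treeOf : (Fin n → Fin n) → Graph n
  treeOf par u v = not (v == root) ∧ (u == par v)

  treeOf-edge : ∀ {par u v} → T (treeOf par u v) → v ≢ root × u ≡ par v
  treeOf-edge t = let v≢root , u==par = to T-∧ t in T-not-==⇒≢ v≢root , ==⇒≡ u==par

  parent-treeOf-edge : ∀ {par v} → v ≢ root → Edge (treeOf par) (par v) v
  parent-treeOf-edge {par} {v} v≢root = from T-∧ (≢⇒T-not-== v≢root , from T-≡ (==-refl (par v)))

  treeOf-root : ∀ par u → treeOf par u root ≡ false
  treeOf-root par u = cong (λ b → not b ∧ (u == par root)) (==-refl root)

  treeOf-nonroot : ∀ par {u v} → v ≢ root → treeOf par u v ≡ (u == par v)
  treeOf-nonroot par {u} {v} v≢root = cong (λ b → not b ∧ (u == par v)) (≢⇒==-false v≢root)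

  treeOf-cong : ∀ {par par′} → (∀ v → par v ≡ par′ v) → ∀ u v → treeOf par u v ≡ treeOf par′ u v
  treeOf-cong par≗par′ u v = cong (λ p → not (v == root) ∧ (u == p)) (par≗par′ v)

  treeOf⊆E : ∀ {par} → IsParentMap par → treeOf par ⊆ᴳ E
  treeOf⊆E {par} isParentMap u v t with treeOf-edge {par} {u} {v} t
  ... | v≢root , refl = isParentMap v v≢root

  treeOf-spanning : ∀ {par} → IsParentMap par → IsRootedSpanningTree E (treeOf par)
  treeOf-spanning {par} isParentMap = treeOf⊆E isParentMap , root , indeg-root , indeg-nonroot ,
                                      λ v → reach v (acyclic⇒wellFounded acyclic v)
    where
    indeg-root : indeg (treeOf par) root ≡ 0
    indeg-root = count-false _ (treeOf-root par)
    indeg-nonroot : ∀ v → v ≢ root → indeg (treeOf par) v ≡ 1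
    indeg-nonroot v v≢root =
      trans (count-cong (λ u → treeOf-nonroot par {u} v≢root)) (count-== (par v))
    reach : ∀ v → Acc (Edge E) v → Star (Edge (treeOf par)) root v
    reach v (acc rs) with v ≟ root
    ... | yes refl    = ε
    ... | no  v≢root = reach (par v) (rs (isParentMap v v≢root)) ◅◅ (parent-treeOf-edge {par} v≢root ◅ ε)

  parentMapIn : (G : Graph n) → (∀ v → v ≢ root → indeg G v ≢ 0) → Fin n → Fin n
  parentMapIn G has-parentᴳ v with v ≟ root
  ... | yes _      = root
  ... | no v≢root = proj₁ (count≢0⇒∃T (λ u → G u v) (has-parentᴳ v v≢root))

  parentMapIn-edge : ∀ G has-parentᴳ v → v ≢ root → Edge G (parentMapIn G has-parentᴳ v) v
  parentMapIn-edge G has-parentᴳ v v≢root with v ≟ root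
  ... | yes v≡root = ⊥-elim (v≢root v≡root)
  ... | no  v≢root = proj₂ (count≢0⇒∃T (λ u → G u v) (has-parentᴳ v v≢root))

  module _ {F : Graph n} (tree : IsRootedSpanningTree E F) where

    private
      F⊆E       = proj₁ tree
      root≡     = spanningTree-root root-source tree
      indeg-F≡0 = subst (λ r → indeg F r ≡ 0) root≡ (proj₁ (proj₂ (proj₂ tree)))

      indeg-F≡1 : ∀ v → v ≢ root → indeg F v ≡ 1
      indeg-F≡1 v v≢root = proj₁ (proj₂ (proj₂ (proj₂ tree))) v (v≢root ∘ flip trans root≡)

    parentOf : Fin n → Fin n
    parentOf = parentMapIn F (λ v v≢root → subst (_≢ 0) (sym (indeg-F≡1 v v≢root)) (λ ()))

    parentOf-edge : ∀ v → v ≢ root → Edge F (parentOf v) v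
    parentOf-edge = parentMapIn-edge F _

    parentOf-isParentMap : IsParentMap parentOf
    parentOf-isParentMap v v≢root = F⊆E _ v (parentOf-edge v v≢root)

    treeOf-parentOf : ∀ u v → treeOf parentOf u v ≡ F u v
    treeOf-parentOf u v = by-cases (v ≟ root)
      where
      by-cases : Dec (v ≡ root) → treeOf parentOf u v ≡ F u v
      by-cases (yes refl) = trans (treeOf-root parentOf u) (sym (¬T⇒≡false (source⇒noEdgeTo {E = F} indeg-F≡0 u)))
      by-cases (no v≢root) = trans (treeOf-nonroot parentOf v≢root) (compare (u ≟ parentOf v))
        where
        compare : Dec (u ≡ parentOf v) → (u == parentOf v) ≡ F u v
        compare (yes refl) = trans (==-refl u) (sym (to T-≡ (parentOf-edge v v≢root)))
        compare (no u≢par) = trans (≢⇒==-false u≢par) (sym (¬T⇒≡false λ Fuv →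
                               u≢par (count≡1⇒unique _ (indeg-F≡1 v v≢root) Fuv (parentOf-edge v v≢root))))

  ParentMapValue : ℕ → Set
  ParentMapValue j = Σ (Fin n → Fin n) λ par → IsParentMap par × nonXLeaves E (treeOf par) ≡ j

  parentMapValue⇒HasLValue : ∀ {j} → ParentMapValue j → HasLValue E j
  parentMapValue⇒HasLValue (par , isParentMap , eq) = treeOf par , treeOf-spanning isParentMap , eq

  HasLValue⇒parentMapValue : ∀ {j} → HasLValue E j → ParentMapValue j
  HasLValue⇒parentMapValue (F , tree , eq) =
    parentOf tree , parentOf-isParentMap tree , trans (nonXLeaves-cong (treeOf-parentOf tree)) eq

  isParentMap? : Decidable IsParentMap
  isParentMap? par = all? (λ v → ¬? (v ≟ root) →-dec T? (E (par v) v))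

  parentMapValue? : Decidable ParentMapValue
  parentMapValue? j =
    map′ fromVec toVec (anyVec? n λ ps → isParentMap? (lookup ps) ×-dec (nonXLeaves E (treeOf (lookup ps)) ≟ℕ j))
    where
    fromVec : (∃ λ ps → IsParentMap (lookup ps) × nonXLeaves E (treeOf (lookup ps)) ≡ j) → ParentMapValue j
    fromVec (ps , isParentMap , eq) = lookup ps , isParentMap , eq
    toVec : ParentMapValue j → ∃ λ ps → IsParentMap (lookup ps) × nonXLeaves E (treeOf (lookup ps)) ≡ j
    toVec (par , isParentMap , eq) =
      tabulate par ,
      (λ v v≢root → subst (λ u → Edge E u v) (sym (lookup∘tabulate par v)) (isParentMap v v≢root)) ,
      trans (nonXLeaves-cong (treeOf-cong (lookup∘tabulate par))) eq

  l-exists : Σ ℕ (IsL E)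
  l-exists with least parentMapValue? (_ , parentMapIn-edge E has-parent , refl)
  ... | k , k-value , k-least = k , parentMapValue⇒HasLValue k-value , λ j → k-least j ∘ HasLValue⇒parentMapValue

-- Attaching leaves

nonXLeaves≡0⇒leaves⊆X : {E F : Graph n} → nonXLeaves E F ≡ 0 → ∀ v → T (isLeaf F v) → T (isLeaf E v)
nonXLeaves≡0⇒leaves⊆X {E = E} none v leafF with isLeaf E v in leafE
... | true  = _
... | false = ⊥-elim (count≡0⇒¬T _ none v (from T-∧ (leafF , from T-not-≡ leafE)))

leaves⊆X⇒nonXLeaves≡0 : {E F : Graph n} → (∀ v → T (isLeaf F v) → T (isLeaf E v)) → nonXLeaves E F ≡ 0
leaves⊆X⇒nonXLeaves≡0 {E = E} {F} leaves⊆X = count-false _ nonX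
  where
  nonX : ∀ v → (isLeaf F v ∧ not (isLeaf E v)) ≡ false
  nonX v with isLeaf F v in leafF
  ... | false = refl
  ... | true  rewrite to T-≡ (leaves⊆X v (from T-≡ leafF)) = refl

subdivide-isLeaf : {E : Graph n} {a b : Fin n} → Edge E a b →
                   ∀ u → isLeaf (subdivide E a b) (suc (suc u)) ≡ isLeaf E u
subdivide-isLeaf {E = E} {a} {b} ab u with u ≟ a
... | yes refl = sym (≢0⇒isZero≡false (λ outdeg≡0 → count≡0⇒¬T (E u) outdeg≡0 b ab))
... | no  _    = cong isZero (count-cong (λ x → ∧-identityʳ (E u x)))

subdivide-source : {E : Graph n} {ρ a b : Fin n} → indeg E ρ ≡ 0 → Edge E a b →
                   indeg (subdivide E a b) (suc (suc ρ)) ≡ 0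
subdivide-source {E = E} {ρ} {a} {b} ρ-source ab
  rewrite ≢⇒==-false {a = ρ} {b} (λ { refl → source⇒noEdgeTo {E = E} ρ-source a ab }) =
  n≤0⇒n≡0 (≤-trans (count-mono _ (λ u → E u ρ) (λ u → proj₁ ∘ to T-∧)) (≤-reflexive ρ-source))

-- F with the subdivision vertex w = zero hung below v and the new leaf y = suc zero below w
extendAt : Graph n → Fin n → Graph (suc (suc n))
extendAt F v zero          (suc zero)    = true
extendAt F v (suc (suc u)) zero          = u == v
extendAt F v (suc (suc u)) (suc (suc x)) = F u x
extendAt F v _             _             = false

extendAt-spanning : {E F : Graph n} {v b : Fin n} → IsRootedSpanningTree E F → (∀ x → ¬ Edge F v x) →
                    IsRootedSpanningTree (subdivide E v b) (extendAt F v)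
extendAt-spanning {n = n} {E} {F} {v} {b} (F⊆E , r , indeg-r , indeg≡1 , reach) v-leaf =
  F′⊆E′ , suc (suc r) , indeg-r , indeg′≡1 , reach′
  where
  F′⊆E′ : extendAt F v ⊆ᴳ subdivide E v b
  F′⊆E′ zero          (suc zero)    _ = _
  F′⊆E′ (suc (suc u)) zero          t = t
  F′⊆E′ (suc (suc u)) (suc (suc x)) t with u ≟ v
  ... | yes refl = ⊥-elim (v-leaf x t)
  ... | no  _    = from T-∧ (F⊆E u x t , _)
  indeg′≡1 : ∀ z → z ≢ suc (suc r) → indeg (extendAt F v) z ≡ 1
  indeg′≡1 zero          _ = count-== v
  indeg′≡1 (suc zero)    _ = cong suc (count-false {n} _ (λ _ → refl))
  indeg′≡1 (suc (suc x)) x≢r = indeg≡1 x (λ { refl → x≢r refl })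
  lift : ∀ {x y} → Star (Edge F) x y → Star (Edge (extendAt F v)) (suc (suc x)) (suc (suc y))
  lift = gmap (λ x → suc (suc x)) id
  reach′ : ∀ z → Star (Edge (extendAt F v)) (suc (suc r)) z
  reach′ zero          = lift (reach v) ◅◅ (from T-≡ (==-refl v) ◅ ε)
  reach′ (suc zero)    = reach′ zero ◅◅ (_ ◅ ε)
  reach′ (suc (suc x)) = lift (reach x)

extendAt-isLeaf : (F : Graph n) (v u : Fin n) → isLeaf (extendAt F v) (suc (suc u)) ≡ isLeaf F u ∧ not (u == v)
extendAt-isLeaf F v u with u == v
... | true  = sym (∧-zeroʳ (isLeaf F u))
... | false = sym (∧-identityʳ (isLeaf F u))

extendAt-nonXLeaves : {E F : Graph n} {v b : Fin n} → Edge E v b → T (isLeaf F v ∧ not (isLeaf E v)) →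
                      suc (nonXLeaves (subdivide E v b) (extendAt F v)) ≡ nonXLeaves E F
extendAt-nonXLeaves {n = n} {E} {F} {v} {b} vb v-nonX
  rewrite count-false {n} (λ _ → false) (λ _ → refl) =
  trans (cong suc (count-cong old)) (sym (count-remove _ v v-nonX))
  where
  old : ∀ u → (isLeaf (extendAt F v) (suc (suc u)) ∧ not (isLeaf (subdivide E v b) (suc (suc u))))
            ≡ ((isLeaf F u ∧ not (isLeaf E u)) ∧ not (u == v))
  old u rewrite extendAt-isLeaf F v u | subdivide-isLeaf {E = E} vb u = begin
    (isLeaf F u ∧ not (u == v)) ∧ not (isLeaf E u)   ≡⟨ ∧-assoc (isLeaf F u) _ _ ⟩
    isLeaf F u ∧ (not (u == v) ∧ not (isLeaf E u))   ≡⟨ cong (isLeaf F u ∧_) (∧-comm (not (u == v)) _) ⟩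
    isLeaf F u ∧ (not (isLeaf E u) ∧ not (u == v))   ≡⟨ ∧-assoc (isLeaf F u) _ _ ⟨
    (isLeaf F u ∧ not (isLeaf E u)) ∧ not (u == v)   ∎
    where open ≡-Reasoning

attach : {E : Graph n} → ∀ j → HasLValue E j → CanBeMadeTreeBasedWith E j
attach zero    (F , tree , none) = _ , done , F , tree , nonXLeaves≡0⇒leaves⊆X none
attach {E = E} (suc j) (F , tree , eq) with count≢0⇒∃T _ (λ eq′ → case trans (sym eq) eq′ of λ ())
... | v , v-nonX with to T-∧ v-nonX
...   | v-leafF , v-innerE with count≢0⇒∃T (E v) (isZero≡false⇒≢0 (to T-not-≡ v-innerE))
...     | b , vb =
  let N′ , attachments , treeBased = attach j (extendAt F v , extendAt-spanning tree v-childless ,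
                                               suc-injective (trans (extendAt-nonXLeaves {E = E} {F} vb v-nonX) eq))
  in N′ , step v b vb attachments , treeBased
  where
  v-childless : ∀ x → ¬ Edge F v x
  v-childless = count≡0⇒¬T (F v) (T-isZero v-leafF)

-- F′ with the subdivision vertex w = zero contracted into a; the new leaf y = suc zero is dropped
contractAt : Graph (suc (suc n)) → Fin n → Graph n
contractAt F′ a u v = F′ (suc (suc u)) (suc (suc v)) ∨ ((u == a) ∧ F′ zero (suc (suc v)))

module Contraction {E : Graph n} {a b : Fin n} (ab : Edge E a b)
                   {F′ : Graph (suc (suc n))} (F′⊆E′ : F′ ⊆ᴳ subdivide E a b) where

  private
    F = contractAt F′ a

    no-edge-from-y : ∀ x → F′ (suc zero) x ≡ false
    no-edge-from-y x = ¬T⇒≡false (F′⊆E′ (suc zero) x)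

    no-edge-to-y : ∀ u → F′ (suc (suc u)) (suc zero) ≡ false
    no-edge-to-y u = ¬T⇒≡false (F′⊆E′ (suc (suc u)) (suc zero))

    edge-to-w : ∀ {u} → Edge F′ (suc (suc u)) zero → u ≡ a
    edge-to-w t = ==⇒≡ (F′⊆E′ _ zero t)

    edge-from-w : ∀ {v} → Edge F′ zero (suc (suc v)) → v ≡ b
    edge-from-w t = ==⇒≡ (F′⊆E′ zero _ t)

    no-edge-ab : F′ (suc (suc a)) (suc (suc b)) ≡ false
    no-edge-ab = ¬T⇒≡false λ t → proj₂ (to T-∧ (subst (λ c → T (E a b ∧ not c))
                   (cong₂ _∧_ (==-refl a) (==-refl b)) (F′⊆E′ _ _ t)))

  contractAt⊆E : F ⊆ᴳ E
  contractAt⊆E u v t with to T-∨ t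
  ... | inj₁ old = proj₁ (to T-∧ (F′⊆E′ _ _ old))
  ... | inj₂ via-w with to T-∧ via-w
  ...   | u==a , w→v with ==⇒≡ {a = u} {a} u==a | edge-from-w w→v
  ...     | refl | refl = ab

  contractAt-indeg : ∀ v → indeg F v ≡ indeg F′ (suc (suc v))
  contractAt-indeg v rewrite no-edge-from-y (suc (suc v)) =
    count-∨-point (λ u → F′ (suc (suc u)) (suc (suc v))) a (F′ zero (suc (suc v)))
      (λ w→v → subst (λ x → F′ (suc (suc a)) (suc (suc x)) ≡ false)
                     (sym (edge-from-w (from T-≡ w→v))) no-edge-ab)

  module _ (v : Fin n) where

    private
      -- a path from w continues at b, and the new leaf y reaches nothing
      ReachesV : Fin (suc (suc n)) → Set
      ReachesV zero          = Star (Edge F) b v × Edge F′ zero (suc (suc b))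
      ReachesV (suc zero)    = ⊥
      ReachesV (suc (suc u)) = Star (Edge F) u v

      project : ∀ {x} → Star (Edge F′) x (suc (suc v)) → ReachesV x
      project ε = ε
      project (_◅_ {zero} {zero} t _) = ⊥-elim (F′⊆E′ zero zero t)
      project (_◅_ {zero} {suc zero} _ path) = ⊥-elim (project path)
      project (_◅_ {zero} {suc (suc x)} t path) with edge-from-w t
      ... | refl = project path , t
      project (_◅_ {suc zero} {x} t _) = ⊥-elim (F′⊆E′ (suc zero) x t)
      project (_◅_ {suc (suc u)} {zero} t path) with edge-to-w t
      ... | refl = let b↝v , w→b = project path
                   in from T-∨ (inj₂ (from T-∧ (from T-≡ (==-refl a) , w→b))) ◅ b↝v
      project (_◅_ {suc (suc u)} {suc zero} t _) = ⊥-elim (F′⊆E′ _ (suc zero) t)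
      project (_◅_ {suc (suc u)} {suc (suc x)} t path) = from T-∨ (inj₁ t) ◅ project path

    contractAt-reach : ∀ {u} → Star (Edge F′) (suc (suc u)) (suc (suc v)) → Star (Edge F) u v
    contractAt-reach = project

  contractAt-nonXLeaves : nonXLeaves E F ≤ suc (nonXLeaves (subdivide E a b) F′)
  contractAt-nonXLeaves = begin
    count nonX                               ≤⟨ count-except nonX (λ u → nonX′ (suc (suc u))) a nonX⊆nonX′ ⟩
    suc (count (λ u → nonX′ (suc (suc u))))  ≤⟨ s≤s (≤-trans (count-suc-≤ (λ u → nonX′ (suc u)))
                                                               (count-suc-≤ nonX′)) ⟩
    suc (nonXLeaves (subdivide E a b) F′)    ∎
    where
    open ≤-Reasoning
    nonX′ : Fin (suc (suc n)) → Bool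
    nonX′ z = isLeaf F′ z ∧ not (isLeaf (subdivide E a b) z)
    nonX : Fin n → Bool
    nonX u = isLeaf F u ∧ not (isLeaf E u)
    nonX⊆nonX′ : ∀ u → u ≢ a → T (nonX u) → T (nonX′ (suc (suc u)))
    nonX⊆nonX′ u u≢a = subst T (sym same)
      where
      no-edge-to-w : F′ (suc (suc u)) zero ≡ false
      no-edge-to-w = ¬T⇒≡false (u≢a ∘ edge-to-w)
      same : nonX′ (suc (suc u)) ≡ nonX u
      same rewrite subdivide-isLeaf {E = E} ab u | no-edge-to-w | no-edge-to-y u | ≢⇒==-false u≢a =
        cong (λ k → isZero k ∧ not (isLeaf E u))
             (count-cong (λ x → sym (∨-identityʳ (F′ (suc (suc u)) (suc (suc x))))))

contract : {E : Graph n} {ρ a b : Fin n} → indeg E ρ ≡ 0 → Edge E a b →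
           ∀ {m} → HasLValue (subdivide E a b) m → Σ ℕ λ m′ → m′ ≤ suc m × HasLValue E m′
contract {E = E} {ρ} {a} {b} ρ-source ab (F′ , tree′@(F′⊆E′ , r′ , indeg-r′ , indeg′≡1 , reach′) , refl) =
  _ , contractAt-nonXLeaves , contractAt F′ a , tree , refl
  where
  open Contraction ab F′⊆E′
  r′≡ρ : r′ ≡ suc (suc ρ)
  r′≡ρ = spanningTree-root (subdivide-source {E = E} ρ-source ab) tree′
  tree : IsRootedSpanningTree E (contractAt F′ a)
  tree = contractAt⊆E , ρ ,
         trans (contractAt-indeg ρ) (subst (λ r → indeg F′ r ≡ 0) r′≡ρ indeg-r′) ,
         (λ v v≢ρ → trans (contractAt-indeg v)
                          (indeg′≡1 _ (λ eq → v≢ρ (suc-injectiveᶠ (suc-injectiveᶠ (trans eq r′≡ρ)))))) ,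
         (λ v → contractAt-reach v (subst (λ r → Star (Edge F′) r (suc (suc v))) r′≡ρ (reach′ (suc (suc v)))))

detach : {E : Graph n} {ρ : Fin n} → indeg E ρ ≡ 0 →
         ∀ {j N′} → AttachSeq j (n , E) N′ → TreeBased (proj₂ N′) → Σ ℕ λ m → m ≤ j × HasLValue E m
detach ρ-source done (F , tree , leaves⊆X) = 0 , z≤n , F , tree , leaves⊆X⇒nonXLeaves≡0 leaves⊆X
detach {E = E} {ρ} ρ-source (step a b ab attachments) treeBased =
  let m  , m≤j   , m-value  = detach {ρ = suc (suc ρ)} (subdivide-source {E = E} ρ-source ab) attachments treeBased
      m′ , m′≤1+m , m′-value = contract ρ-source ab m-value
  in m′ , ≤-trans m′≤1+m (s≤s m≤j) , m′-value

IsL⇒IsT : {E : Graph n} {ρ : Fin n} → indeg E ρ ≡ 0 → ∀ {k} → IsL E k → IsT E k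
IsL⇒IsT ρ-source (k-value , k-least) =
  attach _ k-value ,
  λ j (_ , attachments , treeBased) →
    let m , m≤j , m-value = detach ρ-source attachments treeBased in ≤-trans (k-least m m-value) m≤j

∈⇒↭ : {A : Set} {x : A} {xs : List A} → x ∈ xs → ∃ λ rest → xs ↭ x ∷ rest
∈⇒↭ x∈xs with ∈-∃++ x∈xs
... | ys , zs , refl = ys ++ zs , shift _ ys zs

data Adjacent {A : Set} (a b : A) : List A → Set where
  adj-head : ∀ {r}   → Adjacent a b (a ∷ b ∷ r)
  adj-tail : ∀ {x r} → Adjacent a b r → Adjacent a b (x ∷ r)

module _ {A : Set} where

  Adjacent-++⁺ˡ : ∀ {a b : A} {xs} ys → Adjacent a b xs → Adjacent a b (xs ++ ys)
  Adjacent-++⁺ˡ ys adj-head     = adj-head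
  Adjacent-++⁺ˡ ys (adj-tail a) = adj-tail (Adjacent-++⁺ˡ ys a)

  Adjacent-++⁺ʳ : ∀ {a b : A} xs {ys} → Adjacent a b ys → Adjacent a b (xs ++ ys)
  Adjacent-++⁺ʳ []       a = a
  Adjacent-++⁺ʳ (x ∷ xs) a = adj-tail (Adjacent-++⁺ʳ xs a)

  Adjacent-concat⁺ : ∀ {a b : A} {xss} → Any (Adjacent a b) xss → Adjacent a b (concat xss)
  Adjacent-concat⁺ {xss = xs ∷ xss} (here a)  = Adjacent-++⁺ˡ (concat xss) a
  Adjacent-concat⁺ {xss = xs ∷ xss} (there a) = Adjacent-++⁺ʳ xs (Adjacent-concat⁺ a)

  Adjacent-[-] : ∀ {a b x : A} → ¬ Adjacent a b (x ∷ [])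
  Adjacent-[-] (adj-tail ())

  Adjacent-predecessor : ∀ (z : A) q {v r} → ∃ λ y → Adjacent y v (z ∷ q ++ v ∷ r)
  Adjacent-predecessor z []       = z , adj-head
  Adjacent-predecessor z (z′ ∷ q) = let y , a = Adjacent-predecessor z′ q in y , adj-tail a

  Adjacent-split : ∀ q {u v r} {a b : A} → Adjacent a b (q ++ u ∷ v ∷ r) →
                   Adjacent a b (q ++ u ∷ []) ⊎ (a ≡ u × b ≡ v) ⊎ Adjacent a b (v ∷ r)
  Adjacent-split []          adj-head     = inj₂ (inj₁ (refl , refl))
  Adjacent-split []          (adj-tail a) = inj₂ (inj₂ a)
  Adjacent-split (x ∷ [])    adj-head     = inj₁ adj-head
  Adjacent-split (x ∷ y ∷ q) adj-head     = inj₁ adj-head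
  Adjacent-split (x ∷ q)     (adj-tail a) with Adjacent-split q a
  ... | inj₁ a′ = inj₁ (adj-tail a′)
  ... | inj₂ a′ = inj₂ a′

  Adjacent⇒∈ : ∀ {a b : A} {xs} → Adjacent a b xs → b ∈ xs
  Adjacent⇒∈ adj-head     = there (here refl)
  Adjacent⇒∈ (adj-tail a) = there (Adjacent⇒∈ a)

  Adjacent⇒∈-tail : ∀ {a b z : A} {r} → Adjacent a b (z ∷ r) → b ∈ r
  Adjacent⇒∈-tail adj-head     = here refl
  Adjacent⇒∈-tail (adj-tail a) = Adjacent⇒∈ a

  Adjacent-unique : ∀ {a a′ b : A} {xs} → Unique xs → Adjacent a b xs → Adjacent a′ b xs → a ≡ a′
  Adjacent-unique _                adj-head     adj-head     = refl
  Adjacent-unique (_ ∷ (b∉ ∷ _))   adj-head     (adj-tail a) = ⊥-elim (All.lookup b∉ (Adjacent⇒∈-tail a) refl)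
  Adjacent-unique (_ ∷ (b∉ ∷ _))   (adj-tail a) adj-head     = ⊥-elim (All.lookup b∉ (Adjacent⇒∈-tail a) refl)
  Adjacent-unique (_ ∷ xs!)        (adj-tail a) (adj-tail a′) = Adjacent-unique xs! a a′

  Linked⇒Adjacent⇒R : ∀ {R : A → A → Set} {xs a b} → Linked R xs → Adjacent a b xs → R a b
  Linked⇒Adjacent⇒R (aRb ∷ _) adj-head     = aRb
  Linked⇒Adjacent⇒R (_ ∷ xs↗) (adj-tail a) = Linked⇒Adjacent⇒R xs↗ a
  Linked⇒Adjacent⇒R [-]       (adj-tail ())

  Linked⇒Star : ∀ {R : A → A → Set} {x xs y} → Linked R (x ∷ xs) → y ∈ x ∷ xs → Star R x y
  Linked⇒Star _         (here refl) = ε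
  Linked⇒Star (xRy ∷ l) (there y∈)  = xRy ◅ Linked⇒Star l y∈

  Linked-join : ∀ {R : A → A → Set} q {u v r} → Linked R (q ++ u ∷ []) → Linked R (v ∷ r) → R u v →
                Linked R (q ++ u ∷ v ∷ r)
  Linked-join []          _         v↗ uRv = uRv ∷ v↗
  Linked-join (x ∷ [])    (xRu ∷ _) v↗ uRv = xRu ∷ uRv ∷ v↗
  Linked-join (x ∷ y ∷ q) (xRy ∷ l) v↗ uRv = xRy ∷ Linked-join (y ∷ q) l v↗ uRv

  last-∷ʳ : ∀ (q : List A) v → last (q ++ v ∷ []) ≡ just v
  last-∷ʳ []          v = refl
  last-∷ʳ (x ∷ [])    v = refl
  last-∷ʳ (x ∷ y ∷ q) v = last-∷ʳ (y ∷ q) v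

  concat-↭ : ∀ {xss yss : List (List A)} → xss ↭ yss → concat xss ↭ concat yss
  concat-↭ ↭.refl        = ↭-refl
  concat-↭ (prep xs p)   = ++⁺ˡ xs (concat-↭ p)
  concat-↭ (swap xs ys p) = ↭-trans (++⁺ˡ xs (++⁺ˡ ys (concat-↭ p))) (shifts xs ys)
  concat-↭ (↭.trans p q) = ↭-trans (concat-↭ p) (concat-↭ q)


  Consecutive : List (List A) → A → A → Set
  Consecutive xss a b = Any (Adjacent a b) xss

  Consecutive⇒R : ∀ {R : A → A → Set} {xss a b} → All (Linked R) xss → Consecutive xss a b → R a b
  Consecutive⇒R (xs↗ ∷ _)   (here a)  = Linked⇒Adjacent⇒R xs↗ a
  Consecutive⇒R (_ ∷ xss↗) (there c) = Consecutive⇒R xss↗ c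

  pathStartingAt : ∀ {v : A} {xss} → v ∈ concat xss → (∀ {y} → ¬ Consecutive xss y v) →
                   ∃₂ λ r rest → xss ↭ (v ∷ r) ∷ rest
  pathStartingAt {xss = xss} v∈ no-predecessor with ∈-concat⁻′ xss v∈
  ... | xs , v∈xs , xs∈xss with ∈-∃++ v∈xs | ∈⇒↭ xs∈xss
  ...   | []    , r , refl | rest , xss↭ = r , rest , xss↭
  ...   | z ∷ q , r , refl | _           = ⊥-elim (no-predecessor (lose xs∈xss (proj₂ (Adjacent-predecessor z q))))

  pathEndingAt : ∀ {u : A} {xss} → u ∈ concat xss → (∀ {x} → ¬ Consecutive xss u x) →
                 ∃₂ λ q rest → xss ↭ (q ++ u ∷ []) ∷ rest
  pathEndingAt {xss = xss} u∈ no-successor with ∈-concat⁻′ xss u∈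
  ... | xs , u∈xs , xs∈xss with ∈-∃++ u∈xs | ∈⇒↭ xs∈xss
  ...   | q , []    , refl | rest , xss↭ = q , rest , xss↭
  ...   | q , x ∷ r , refl | _           = ⊥-elim (no-successor (lose xs∈xss (Adjacent-++⁺ʳ q adj-head)))

-- Path partitions

step⇒TransClosure : {A : Set} {R : A → A → Set} {x y z : A} → R x y → Star R y z → TransClosure R x z
step⇒TransClosure xRy ε          = [ xRy ]⁺
step⇒TransClosure xRy (yRw ◅ w↝z) = xRy ∷ step⇒TransClosure yRw w↝z

length-singletons : length (map [_] (allFin n)) ≡ n
length-singletons {n} = trans (length-map [_] (allFin n)) (length-tabulate id)

singletons-unjoined : {a b : Fin n} → ¬ Consecutive (map [_] (allFin n)) a b
singletons-unjoined = Adjacent-[-] ∘ proj₂ ∘ satisfied ∘ Anyₚ.map⁻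

module _ {E : Graph n} where

  singletons-partition : IsPathPartition E (map [_] (allFin n))
  singletons-partition = Allₚ.map⁺ (All.universal (λ _ ()) _) ,
                         Allₚ.map⁺ (All.universal (λ _ → [-]) _) ,
                         ↭.↭-reflexive (concat-map-[ allFin n ])

  join-paths : ∀ {ps u v q r rest} →
               IsPathPartition E ps → ps ↭ (v ∷ r) ∷ (q ++ u ∷ []) ∷ rest → Edge E u v →
               let ps′ = (q ++ u ∷ v ∷ r) ∷ rest in
               IsPathPartition E ps′ × suc (length ps′) ≡ length ps ×
               (∀ {a b} → Consecutive ps′ a b → (a ≡ u × b ≡ v) ⊎ Consecutive ps a b)
  join-paths {ps} {u} {v} {q} {r} {rest} (nonempty , linked , ps↭V) ps↭ uv =
    (nonempty′ , linked′ , concat-ps′↭V) , sym (↭-length ps↭) , consecutive′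
    where
    nonempty₃ = All-resp-↭ ps↭ nonempty
    linked₃   = All-resp-↭ ps↭ linked
    nonempty′ : All (_≢ []) ((q ++ u ∷ v ∷ r) ∷ rest)
    nonempty′ = (λ eq → case ++-conicalʳ q _ eq of λ ()) ∷ All.tail (All.tail nonempty₃)
    linked′ : All (Linked (Edge E)) ((q ++ u ∷ v ∷ r) ∷ rest)
    linked′ = Linked-join q (All.head (All.tail linked₃)) (All.head linked₃) uv ∷ All.tail (All.tail linked₃)
    concat-ps′↭V : concat ((q ++ u ∷ v ∷ r) ∷ rest) ↭ allFin n
    concat-ps′↭V = begin
      (q ++ u ∷ v ∷ r) ++ concat rest          ≡⟨ ++-assoc q (u ∷ v ∷ r) (concat rest) ⟩
      q ++ u ∷ (v ∷ r) ++ concat rest          ≡⟨ ++-assoc q (u ∷ []) ((v ∷ r) ++ concat rest) ⟨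
      (q ++ u ∷ []) ++ (v ∷ r) ++ concat rest  ↭⟨ shifts (q ++ u ∷ []) (v ∷ r) ⟩
      concat ((v ∷ r) ∷ (q ++ u ∷ []) ∷ rest)  ↭⟨ concat-↭ (↭-sym ps↭) ⟩
      concat ps                                ↭⟨ ps↭V ⟩
      allFin n                                 ∎
      where open ↭.PermutationReasoning
    from-ps : ∀ {a b} → Consecutive ((v ∷ r) ∷ (q ++ u ∷ []) ∷ rest) a b → Consecutive ps a b
    from-ps = Any-resp-↭ (↭-sym ps↭)
    consecutive′ : ∀ {a b} → Consecutive ((q ++ u ∷ v ∷ r) ∷ rest) a b →
                   (a ≡ u × b ≡ v) ⊎ Consecutive ps a b
    consecutive′ (there c) = inj₂ (from-ps (there (there c)))
    consecutive′ (here a) with Adjacent-split q a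
    ... | inj₁ a′        = inj₂ (from-ps (there (here a′)))
    ... | inj₂ (inj₁ uv′) = inj₁ uv′
    ... | inj₂ (inj₂ a′) = inj₂ (from-ps (here a′))

module PathJoining {E : Graph n} (acyclic : Acyclic E) (d : Fin n → Fin n) where

  JoinedAlong : List (Fin n) → List (List (Fin n)) → Set
  JoinedAlong L ps = ∀ {a b} → Consecutive ps a b → a ∈ L × b ≡ d a

  private
    extend-joined : ∀ {L ps ps′ u} → JoinedAlong L ps →
                    (∀ {a b} → Consecutive ps′ a b → (a ≡ u × b ≡ d u) ⊎ Consecutive ps a b) →
                    JoinedAlong (u ∷ L) ps′
    extend-joined joined consecutive′ c with consecutive′ c
    ... | inj₁ (refl , refl) = here refl , refl
    ... | inj₂ c′            = there (proj₁ (joined c′)) , proj₂ (joined c′)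

  -- d u starts a path (d is injective on u ∷ L) and u ends another one (u ∉ L), which acyclicity keeps distinct
  join-step : ∀ {L ps u} → IsPathPartition E ps → JoinedAlong L ps → u ∉ L → d u ∉ map d L → Edge E u (d u) →
              ∃ λ ps′ → IsPathPartition E ps′ × suc (length ps′) ≡ length ps × JoinedAlong (u ∷ L) ps′
  join-step {L} {ps} {u} partition@(_ , linked , ps↭V) joined u∉L du∉dL u→du
    with pathStartingAt (∈-resp-↭ (↭-sym ps↭V) (∈-allFin (d u))) no-predecessor
    where
    no-predecessor : ∀ {y} → ¬ Consecutive ps y (d u)
    no-predecessor c = let y∈L , du≡dy = joined c in du∉dL (subst (_∈ map d L) (sym du≡dy) (∈-map⁺ d y∈L))
  ... | r , rest , ps↭
    with ∈-++⁻ (d u ∷ r) (∈-resp-↭ (concat-↭ ps↭) (∈-resp-↭ (↭-sym ps↭V) (∈-allFin u)))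
  ...   | inj₁ u∈path = ⊥-elim (acyclic u (step⇒TransClosure u→du
                          (Linked⇒Star (All.head (All-resp-↭ ps↭ linked)) u∈path)))
  ...   | inj₂ u∈rest
    with pathEndingAt u∈rest (λ c → u∉L (proj₁ (joined (Any-resp-↭ (↭-sym ps↭) (there c)))))
  ...     | q , rest′ , rest↭ with join-paths partition (↭-trans ps↭ (prep _ rest↭)) u→du
  ...       | partition′ , length′ , consecutive′ = _ , partition′ , length′ , extend-joined joined consecutive′

  join : ∀ L → Unique L → Unique (map d L) → All (λ u → Edge E u (d u)) L →
         ∃ λ ps → IsPathPartition E ps × length ps + length L ≡ n × JoinedAlong L ps
  join [] _ _ _ =
    _ , singletons-partition {E = E} , trans (+-identityʳ _) length-singletons , ⊥-elim ∘ singletons-unjoined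
  join (u ∷ L) (u∉L ∷ L!) (du∉dL ∷ dL!) (u→du ∷ edges) with join L L! dL! edges
  ... | ps , partition , length-ps , joined
    with join-step partition joined (Allₚ.All¬⇒¬Any u∉L) (Allₚ.All¬⇒¬Any du∉dL) u→du
  ...   | ps′ , partition′ , length′ , joined′ =
    ps′ , partition′ , trans (+-suc (length ps′) (length L)) (trans (cong (_+ length L) length′) length-ps) , joined′

pathPartition-along : {E : Graph n} → Acyclic E → (d : Fin n → Fin n) →
                      ∀ L → Unique L → Unique (map d L) → All (λ u → Edge E u (d u)) L →
                      ∃ λ ps → IsPathPartition E ps × length ps + length L ≡ n
pathPartition-along acyclic d L L! dL! edges =
  let ps , partition , length-ps , _ = PathJoining.join acyclic d L L! dL! edges in ps , partition , length-ps

adjacent? : (a b : Fin n) → ∀ xs → Dec (Adjacent a b xs)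
adjacent? a b []          = no λ ()
adjacent? a b (x ∷ [])    = no Adjacent-[-]
adjacent? a b (x ∷ y ∷ r) with x ≟ a | y ≟ b | adjacent? a b (y ∷ r)
... | yes refl | yes refl | _      = yes adj-head
... | _        | _        | yes a′ = yes (adj-tail a′)
... | no x≢a   | _        | no ¬a′ = no λ { adj-head → x≢a refl ; (adj-tail a′) → ¬a′ a′ }
... | yes _    | no y≢b   | no ¬a′ = no λ { adj-head → y≢b refl ; (adj-tail a′) → ¬a′ a′ }

length-filterᵇ-tabulate : ∀ {m} (f : Fin m → Bool) (g : Fin n → Fin m) →
                          length (filterᵇ f (tabulateᴸ g)) ≡ count (f ∘ g)
length-filterᵇ-tabulate {zero}  f g = refl
length-filterᵇ-tabulate {suc n} f g with f (g zero)
... | true  = cong suc (length-filterᵇ-tabulate f (g ∘ suc))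
... | false = length-filterᵇ-tabulate f (g ∘ suc)

⊆ᴳ-isLeaf : {E F : Graph n} → F ⊆ᴳ E → ∀ v → T (isLeaf E v) → isLeaf F v ≡ true
⊆ᴳ-isLeaf {E = E} {F} F⊆E v leafE
  rewrite n≤0⇒n≡0 (≤-trans (count-mono (F v) (E v) (F⊆E v)) (≤-reflexive (T-isZero leafE))) = refl

leaves≡leafCount+nonXLeaves : {E F : Graph n} → F ⊆ᴳ E → count (isLeaf F) ≡ leafCount E + nonXLeaves E F
leaves≡leafCount+nonXLeaves {E = E} {F} F⊆E =
  trans (count-∧-partition (isLeaf F) (isLeaf E)) (cong (_+ nonXLeaves E F) (count-cong leafE⇒leafF))
  where
  leafE⇒leafF : ∀ v → (isLeaf F v ∧ isLeaf E v) ≡ isLeaf E v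
  leafE⇒leafF v with isLeaf E v in leafE
  ... | false = ∧-zeroʳ _
  ... | true  rewrite ⊆ᴳ-isLeaf F⊆E v (from T-≡ leafE) = refl

module PathPartitions {E : Graph n} (dag : IsRootedDAG E) where

  open IsRootedDAG dag
  open RootedDAG dag

  module ChosenChildren (par : Fin n → Fin n) where

    inner : Fin n → Bool
    inner = not ∘ isLeaf (treeOf par)

    innerVertices : List (Fin n)
    innerVertices = filterᵇ inner (allFin n)

    child : Fin n → Fin n
    child u with outdeg (treeOf par) u ≟ℕ 0
    ... | yes _         = u
    ... | no  has-child = proj₁ (count≢0⇒∃T (treeOf par u) has-child)

    child-edge : ∀ {u} → T (inner u) → Edge (treeOf par) u (child u)
    child-edge {u} t with outdeg (treeOf par) u ≟ℕ 0
    ... | yes outdeg≡0  = ⊥-elim (subst (T ∘ not ∘ isZero) outdeg≡0 t)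
    ... | no  has-child = proj₂ (count≢0⇒∃T (treeOf par u) has-child)

    innerVertices-inner : All (T ∘ inner) innerVertices
    innerVertices-inner = Allₚ.all-filter (T? ∘ inner) (allFin n)

    innerVertices! : Unique innerVertices
    innerVertices! = Uniqueₚ.filter⁺ (T? ∘ inner) (Uniqueₚ.allFin⁺ n)

    children! : Unique (map child innerVertices)
    children! = Uniqueₚ.map⁻ (subst Unique (sym par∘child≡id) innerVertices!)
      where
      par∘child≡id : map par (map child innerVertices) ≡ innerVertices
      par∘child≡id = trans (sym (map-∘ innerVertices)) (map-id-local
        (All.map (λ t → sym (proj₂ (treeOf-edge {par} (child-edge t)))) innerVertices-inner))

  HasLValue⇒pathPartition : ∀ {j} → HasLValue E j → HasPathPartitionOfSize E (j + leafCount E)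
  HasLValue⇒pathPartition {j} value with HasLValue⇒parentMapValue value
  ... | par , isParentMap , nonX≡j = ps , proj₁ (proj₂ joined) , length-ps
    where
    open ChosenChildren par
    joined = pathPartition-along acyclic child innerVertices innerVertices! children!
               (All.map (treeOf⊆E isParentMap _ _ ∘ child-edge) innerVertices-inner)
    ps   = proj₁ joined
    tree = treeOf par
    length-ps : length ps ≡ j + leafCount E
    length-ps = +-cancelʳ-≡ (count inner) (length ps) (j + leafCount E) (begin
      length ps + count inner                      ≡⟨ cong (length ps +_) (length-filterᵇ-tabulate inner id) ⟨
      length ps + length innerVertices             ≡⟨ proj₂ (proj₂ joined) ⟩
      n                                            ≡⟨ count+count-not (isLeaf tree) ⟨
      count (isLeaf tree) + count inner            ≡⟨ cong (_+ count inner) leaves≡ ⟩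
      (leafCount E + nonXLeaves E tree) + count inner ≡⟨ cong (λ k → (leafCount E + k) + count inner) nonX≡j ⟩
      (leafCount E + j) + count inner              ≡⟨ cong (_+ count inner) (+-comm (leafCount E) j) ⟩
      (j + leafCount E) + count inner              ∎)
      where
      open ≡-Reasoning
      leaves≡ = leaves≡leafCount+nonXLeaves (treeOf⊆E isParentMap)

  module PredecessorParents {ps} (partition : IsPathPartition E ps) where

    private
      linked = proj₁ (proj₂ partition)
      ps↭V   = proj₂ (proj₂ partition)

      concat! : Unique (concat ps)
      concat! = ↭ₛ.Unique-resp-↭ (setoid (Fin n)) (↭⇒↭ₛ (↭-sym ps↭V)) (Uniqueₚ.allFin⁺ n)

      predecessor? : ∀ w → Dec (∃ λ u → Consecutive ps u w)
      predecessor? w = any? (λ u → Any.any? (adjacent? u w) ps)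

      parent : ∀ w → Dec (∃ λ u → Consecutive ps u w) → Fin n
      parent w (yes (u , _)) = u
      parent w (no _)        = parentMapIn E has-parent w

    par : Fin n → Fin n
    par w = parent w (predecessor? w)

    isParentMap : IsParentMap par
    isParentMap w w≢root with predecessor? w
    ... | yes (u , c) = Consecutive⇒R linked c
    ... | no  _       = parentMapIn-edge E has-parent w w≢root

    par-consecutive : ∀ {u w} → Consecutive ps u w → par w ≡ u
    par-consecutive {u} {w} c with predecessor? w
    ... | yes (u′ , c′) = Adjacent-unique concat! (Adjacent-concat⁺ c′) (Adjacent-concat⁺ c)
    ... | no  none      = ⊥-elim (none (u , c))

    leaf⇒pathEnd : ∀ v → T (isLeaf (treeOf par) v) → v ∈ mapMaybe last ps
    leaf⇒pathEnd v leaf with ∈-concat⁻′ ps (∈-resp-↭ (↭-sym ps↭V) (∈-allFin v))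
    ... | p , v∈p , p∈ps with ∈-∃++ v∈p
    ...   | q , []    , refl =
      Anyₚ.mapMaybe⁺ last ps (Anyₚ.map⁺ (lose p∈ps (subst (MaybeAny (v ≡_)) (sym (last-∷ʳ q v)) (just refl))))
    ...   | q , x ∷ r , refl = ⊥-elim (count≡0⇒¬T _ (T-isZero leaf) x v→x)
      where
      c : Consecutive ps v x
      c = lose p∈ps (Adjacent-++⁺ʳ q adj-head)
      x≢root : x ≢ root
      x≢root refl = source⇒noEdgeTo {E = E} root-source v (Consecutive⇒R linked c)
      v→x : Edge (treeOf par) v x
      v→x = subst (λ u → Edge (treeOf par) u x) (par-consecutive c) (parent-treeOf-edge {par} x≢root)

  pathPartition⇒HasLValue : ∀ {m} → HasPathPartitionOfSize E m → ∃ λ j → HasLValue E j × j + leafCount E ≤ m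
  pathPartition⇒HasLValue (ps , partition , refl) =
    _ , parentMapValue⇒HasLValue (par , isParentMap , refl) , bound
    where
    open PredecessorParents partition
    bound : nonXLeaves E (treeOf par) + leafCount E ≤ length ps
    bound = begin
      nonXLeaves E (treeOf par) + leafCount E  ≡⟨ +-comm _ (leafCount E) ⟩
      leafCount E + nonXLeaves E (treeOf par)  ≡⟨ leaves≡leafCount+nonXLeaves (treeOf⊆E isParentMap) ⟨
      count (isLeaf (treeOf par))              ≤⟨ count-≤-length _ (mapMaybe last ps) leaf⇒pathEnd ⟩
      length (mapMaybe last ps)                ≤⟨ length-mapMaybe last ps ⟩
      length ps                                ∎
      where open ≤-Reasoning

  IsL⇒IsP : ∀ {k} → IsL E k → IsP E k
  IsL⇒IsP (k-value , k-least) =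
    HasLValue⇒pathPartition k-value ,
    λ m partition → let j , j-value , j+X≤m = pathPartition⇒HasLValue partition
                    in ≤-trans (+-monoˡ-≤ (leafCount E) (k-least j j-value)) j+X≤m

network⇒rootedDAG : {E : Graph n} → IsNetwork E → IsRootedDAG E
network⇒rootedDAG (inj₁ (refl , no-edges)) = record
  { root        = zero
  ; root-source = count-false _ (λ u → ¬T⇒≡false (no-edges u zero))
  ; has-parent  = λ { zero 0≢0 → ⊥-elim (0≢0 refl) }
  ; acyclic     = λ { _ [ e ]⁺ → no-edges _ _ e ; _ (e ∷ _) → no-edges _ _ e }
  }
network⇒rootedDAG {E = E} (inj₂ (acyclic , ρ , ρ-source , _ , _ , degrees)) = record
  { root        = ρ
  ; root-source = ρ-source
  ; has-parent  = λ v v≢ρ → indeg≢0 (degrees v v≢ρ)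
  ; acyclic     = acyclic
  }
  where
  indeg≢0 : ∀ {v d₁ d₂ d₃} →
            (indeg E v ≡ 1 × d₁) ⊎ (indeg E v ≡ 1 × d₂) ⊎ (indeg E v ≡ 2 × d₃) → indeg E v ≢ 0
  indeg≢0 (inj₁ (indeg≡1 , _))        indeg≡0 = case trans (sym indeg≡1) indeg≡0 of λ ()
  indeg≢0 (inj₂ (inj₁ (indeg≡1 , _))) indeg≡0 = case trans (sym indeg≡1) indeg≡0 of λ ()
  indeg≢0 (inj₂ (inj₂ (indeg≡2 , _))) indeg≡0 = case trans (sym indeg≡2) indeg≡0 of λ ()

theorem4 : (n : ℕ) (E : Graph n) → IsNetwork E →
    Σ ℕ λ k → IsL E k × IsP E k × IsT E k
theorem4 n E network = k , isL , PathPartitions.IsL⇒IsP dag isL , IsL⇒IsT (IsRootedDAG.root-source dag) isL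
  where
  dag = network⇒rootedDAG network
  k   = proj₁ (RootedDAG.l-exists dag)
  isL = proj₂ (RootedDAG.l-exists dag)
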